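{- For every $\varphi\in\mathit{Fm}$, $\vdash_{\mathrm{HPRL}^{re}}\varphi$ if and only if $\vdash_{\mathrm{HPRL}}\varphi$.
   Context: Language $\{\land,\lor,\longrightarrow,\neg,I,C,0,1\}$ with arities $2,2,2,1,1,1,0,0$; $\mathit{Fm}$ is the set of formulas over a countably infinite set $V$ of variables; $\mathrm{var}(\varphi)$ is the set of variables of $\varphi$. Both logics are Hilbert-style (theorems are formulas derivable from no hypotheses via finite sequences of axiom instances and rule applications) with the axiom schemes: (A1) $\alpha\longrightarrow\neg\neg\alpha$; (A2) $\neg\neg\alpha\longrightarrow\alpha$; (A3) $(\alpha\land\beta)\longrightarrow\beta$; (A4) $(\alpha\land\beta)\longrightarrow(\beta\land\alpha)$; (A5) $(\alpha\land(\beta\lor\gamma))\longrightarrow((\alpha\land\beta)\lor(\alpha\land\gamma))$; (A6) $((\alpha\land\beta)\lor(\alpha\land\gamma))\longrightarrow(\alpha\land(\beta\lor\gamma))$; (A7) $(\alpha\lor\beta)\longrightarrow\neg(\neg\alpha\land\neg\beta)$; (A8) $\neg(\neg\alpha\land\neg\beta)\longrightarrow(\alpha\lor\beta)$; (A9) $C\alpha\longrightarrow\neg I\neg\alpha$; (A10) $\neg I\neg\alpha\longrightarrow C\alpha$; (A11) $I\alpha\longrightarrow\alpha$; (A12) $(I\alpha\land I\beta)\longrightarrow I(\alpha\land\beta)$; (A13) $(\alpha\longrightarrow\beta)\longrightarrow((\neg I\alpha\lor I\beta)\land(\neg C\alpha\lor C\beta))$; (A14) $((\neg I\alpha\lor I\beta)\land(\neg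 C\alpha\lor C\beta))\longrightarrow(\alpha\longrightarrow\beta)$. HPRL has the rules: (R1) from $\alpha$ and $\alpha\longrightarrow\beta$ infer $\beta$; (R2) from $\alpha\longrightarrow\beta$ and $\beta\longrightarrow\gamma$ infer $\alpha\longrightarrow\gamma$; (R3) from $\alpha$ infer $\beta\longrightarrow\alpha$; (R4) from $\alpha\longrightarrow\beta$ infer $\neg\beta\longrightarrow\neg\alpha$; (R5) from $\alpha\longrightarrow\beta$, $\alpha\longrightarrow\gamma$ infer $\alpha\longrightarrow(\beta\land\gamma)$; (R6) from $\alpha\longrightarrow\beta$, $\beta\longrightarrow\alpha$, $\gamma\longrightarrow\delta$, $\delta\longrightarrow\gamma$ infer $(\alpha\longrightarrow\gamma)\longrightarrow(\beta\longrightarrow\delta)$; (R7) from $\alpha\longrightarrow\beta$ infer $I\alpha\longrightarrow I\beta$; (R8) from $\alpha$ infer $I\alpha$; (R9) from $I\alpha\longrightarrow I\beta$ and $C\alpha\longrightarrow C\beta$ infer $\alpha\longrightarrow\beta$. $\mathrm{HPRL}^{re}$ has the same axioms and rules (R3)–(R9), but (R1) and (R2) replaced by: (R1$'$) (R1) provided $\mathrm{var}(\alpha)\subseteq\mathrm{var}(\beta)$; (R2$'$) (R2) provided $\mathrm{var}(\beta)\subseteq\mathrm{var}(\alpha)\cup\mathrm{var}(\gamma)$. -}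

module Defs where

open import Data.Nat using (ℕ)
open import Data.Sum using (_⊎_)
open import Data.Empty using (⊥)
open import Relation.Binary.PropositionalEquality using (_≡_)

Var : Set
Var = ℕ

infixr 5 _⟶_
infixl 6 _∨_
infixl 7 _∧_
data Fm : Set where
  var  : Var → Fm
  _∧_  : Fm → Fm → Fm
  _∨_  : Fm → Fm → Fm
  _⟶_ : Fm → Fm → Fm
  ¬_   : Fm → Fm
  I    : Fm → Fm
  C    : Fm → Fm
  𝟘    : Fm
  𝟙    : Fm

_∈var_ : Var → Fm → Set
x ∈var var y = x ≡ y
x ∈var (a ∧ b) = x ∈var a ⊎ x ∈var b
x ∈var (a ∨ b) = x ∈var a ⊎ x ∈var b
x ∈var (a ⟶ b) = x ∈var a ⊎ x ∈var b
x ∈var (¬ a) = x ∈var a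
x ∈var I a = x ∈var a
x ∈var C a = x ∈var a
x ∈var 𝟘 = ⊥
x ∈var 𝟙 = ⊥

_⊆var_ : Fm → Fm → Set
a ⊆var b = ∀ x → x ∈var a → x ∈var b

_⊆var_∪_ : Fm → Fm → Fm → Set
b ⊆var a ∪ c = ∀ x → x ∈var b → x ∈var a ⊎ x ∈var c

data Axiom : Fm → Set where
  A1  : ∀ a → Axiom (a ⟶ ¬ ¬ a)
  A2  : ∀ a → Axiom (¬ ¬ a ⟶ a)
  A3  : ∀ a b → Axiom ((a ∧ b) ⟶ b)
  A4  : ∀ a b → Axiom ((a ∧ b) ⟶ (b ∧ a))
  A5  : ∀ a b c → Axiom ((a ∧ (b ∨ c)) ⟶ ((a ∧ b) ∨ (a ∧ c)))
  A6  : ∀ a b c → Axiom (((a ∧ b) ∨ (a ∧ c)) ⟶ (a ∧ (b ∨ c)))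
  A7  : ∀ a b → Axiom ((a ∨ b) ⟶ ¬ (¬ a ∧ ¬ b))
  A8  : ∀ a b → Axiom (¬ (¬ a ∧ ¬ b) ⟶ (a ∨ b))
  A9  : ∀ a → Axiom (C a ⟶ ¬ I (¬ a))
  A10 : ∀ a → Axiom (¬ I (¬ a) ⟶ C a)
  A11 : ∀ a → Axiom (I a ⟶ a)
  A12 : ∀ a b → Axiom ((I a ∧ I b) ⟶ I (a ∧ b))
  A13 : ∀ a b → Axiom ((a ⟶ b) ⟶ ((¬ I a ∨ I b) ∧ (¬ C a ∨ C b)))
  A14 : ∀ a b → Axiom (((¬ I a ∨ I b) ∧ (¬ C a ∨ C b)) ⟶ (a ⟶ b))

data ⊢HPRL : Fm → Set where
  ax : ∀ {a} → Axiom a → ⊢HPRL a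
  R1 : ∀ {a b} → ⊢HPRL a → ⊢HPRL (a ⟶ b) → ⊢HPRL b
  R2 : ∀ {a b c} → ⊢HPRL (a ⟶ b) → ⊢HPRL (b ⟶ c) → ⊢HPRL (a ⟶ c)
  R3 : ∀ {a} b → ⊢HPRL a → ⊢HPRL (b ⟶ a)
  R4 : ∀ {a b} → ⊢HPRL (a ⟶ b) → ⊢HPRL (¬ b ⟶ ¬ a)
  R5 : ∀ {a b c} → ⊢HPRL (a ⟶ b) → ⊢HPRL (a ⟶ c) → ⊢HPRL (a ⟶ (b ∧ c))
  R6 : ∀ {a b c d} → ⊢HPRL (a ⟶ b) → ⊢HPRL (b ⟶ a) → ⊢HPRL (c ⟶ d) → ⊢HPRL (d ⟶ c)
       → ⊢HPRL ((a ⟶ c) ⟶ (b ⟶ d))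
  R7 : ∀ {a b} → ⊢HPRL (a ⟶ b) → ⊢HPRL (I a ⟶ I b)
  R8 : ∀ {a} → ⊢HPRL a → ⊢HPRL (I a)
  R9 : ∀ {a b} → ⊢HPRL (I a ⟶ I b) → ⊢HPRL (C a ⟶ C b) → ⊢HPRL (a ⟶ b)

data ⊢HPRLre : Fm → Set where
  ax  : ∀ {a} → Axiom a → ⊢HPRLre a
  R1′ : ∀ {a b} → a ⊆var b → ⊢HPRLre a → ⊢HPRLre (a ⟶ b) → ⊢HPRLre b
  R2′ : ∀ {a b c} → b ⊆var a ∪ c → ⊢HPRLre (a ⟶ b) → ⊢HPRLre (b ⟶ c) → ⊢HPRLre (a ⟶ c)
  R3  : ∀ {a} b → ⊢HPRLre a → ⊢HPRLre (b ⟶ a)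
  R4  : ∀ {a b} → ⊢HPRLre (a ⟶ b) → ⊢HPRLre (¬ b ⟶ ¬ a)
  R5  : ∀ {a b c} → ⊢HPRLre (a ⟶ b) → ⊢HPRLre (a ⟶ c) → ⊢HPRLre (a ⟶ (b ∧ c))
  R6  : ∀ {a b c d} → ⊢HPRLre (a ⟶ b) → ⊢HPRLre (b ⟶ a) → ⊢HPRLre (c ⟶ d) → ⊢HPRLre (d ⟶ c)
        → ⊢HPRLre ((a ⟶ c) ⟶ (b ⟶ d))
  R7  : ∀ {a b} → ⊢HPRLre (a ⟶ b) → ⊢HPRLre (I a ⟶ I b)
  R8  : ∀ {a} → ⊢HPRLre a → ⊢HPRLre (I a)
  R9  : ∀ {a b} → ⊢HPRLre (I a ⟶ I b) → ⊢HPRLre (C a ⟶ C b) → ⊢HPRLre (a ⟶ b)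

module Submission where

-- It suffices that unrestricted (R1) and (R2) are admissible in HPRL^re. Derivability in
-- HPRL^re is closed under substitution, since substitution preserves the variable conditions
-- of (R1′) and (R2′). Given premises of (R1) or (R2), substitute the constant 𝟙 for every
-- variable not occurring in the conclusion: the conclusion is unchanged, and all variables of
-- the substituted premises now occur in the conclusion, so the side conditions hold.

open import Defs
open import Data.Nat using (_≟_)
open import Data.Product using (_×_; _,_; ∃; map₁; map₂)
open import Data.Sum using (inj₁; inj₂)
import Data.Sum as Sum
open import Function using (_∘_)
open import Relation.Nullary using (Dec; yes; no)
open import Relation.Nullary.Decidable using (_⊎-dec_)
open import Relation.Binary.PropositionalEquality using (_≡_; refl; cong; cong₂; subst; subst₂)

Subst : Set
Subst = Var → Fm

sub : Subst → Fm → Fm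
sub σ (var x) = σ x
sub σ (a ∧ b) = sub σ a ∧ sub σ b
sub σ (a ∨ b) = sub σ a ∨ sub σ b
sub σ (a ⟶ b) = sub σ a ⟶ sub σ b
sub σ (¬ a) = ¬ sub σ a
sub σ (I a) = I (sub σ a)
sub σ (C a) = C (sub σ a)
sub σ 𝟘 = 𝟘
sub σ 𝟙 = 𝟙

∈var-sub⁻ : ∀ σ a {x} → x ∈var sub σ a → ∃ λ y → y ∈var a × x ∈var σ y
∈var-sub⁻ σ (var y) m = y , refl , m
∈var-sub⁻ σ (a ∧ b) (inj₁ m) = map₂ (map₁ inj₁) (∈var-sub⁻ σ a m)
∈var-sub⁻ σ (a ∧ b) (inj₂ m) = map₂ (map₁ inj₂) (∈var-sub⁻ σ b m)
∈var-sub⁻ σ (a ∨ b) (inj₁ m) = map₂ (map₁ inj₁) (∈var-sub⁻ σ a m)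
∈var-sub⁻ σ (a ∨ b) (inj₂ m) = map₂ (map₁ inj₂) (∈var-sub⁻ σ b m)
∈var-sub⁻ σ (a ⟶ b) (inj₁ m) = map₂ (map₁ inj₁) (∈var-sub⁻ σ a m)
∈var-sub⁻ σ (a ⟶ b) (inj₂ m) = map₂ (map₁ inj₂) (∈var-sub⁻ σ b m)
∈var-sub⁻ σ (¬ a) m = ∈var-sub⁻ σ a m
∈var-sub⁻ σ (I a) m = ∈var-sub⁻ σ a m
∈var-sub⁻ σ (C a) m = ∈var-sub⁻ σ a m

∈var-sub⁺ : ∀ σ a {x y} → y ∈var a → x ∈var σ y → x ∈var sub σ a
∈var-sub⁺ σ (var z) refl q = q
∈var-sub⁺ σ (a ∧ b) (inj₁ p) q = inj₁ (∈var-sub⁺ σ a p q)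
∈var-sub⁺ σ (a ∧ b) (inj₂ p) q = inj₂ (∈var-sub⁺ σ b p q)
∈var-sub⁺ σ (a ∨ b) (inj₁ p) q = inj₁ (∈var-sub⁺ σ a p q)
∈var-sub⁺ σ (a ∨ b) (inj₂ p) q = inj₂ (∈var-sub⁺ σ b p q)
∈var-sub⁺ σ (a ⟶ b) (inj₁ p) q = inj₁ (∈var-sub⁺ σ a p q)
∈var-sub⁺ σ (a ⟶ b) (inj₂ p) q = inj₂ (∈var-sub⁺ σ b p q)
∈var-sub⁺ σ (¬ a) p q = ∈var-sub⁺ σ a p q
∈var-sub⁺ σ (I a) p q = ∈var-sub⁺ σ a p q
∈var-sub⁺ σ (C a) p q = ∈var-sub⁺ σ a p q

sub-⊆var : ∀ σ {a b} → a ⊆var b → sub σ a ⊆var sub σ b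
sub-⊆var σ {a} {b} a⊆b x m with ∈var-sub⁻ σ a m
... | y , y∈a , x∈σy = ∈var-sub⁺ σ b (a⊆b y y∈a) x∈σy

sub-⊆var∪ : ∀ σ {a b c} → b ⊆var a ∪ c → sub σ b ⊆var sub σ a ∪ sub σ c
sub-⊆var∪ σ {a} {b} {c} b⊆a∪c x m with ∈var-sub⁻ σ b m
... | y , y∈b , x∈σy =
  Sum.map (λ y∈a → ∈var-sub⁺ σ a y∈a x∈σy) (λ y∈c → ∈var-sub⁺ σ c y∈c x∈σy) (b⊆a∪c y y∈b)

sub-fixes : ∀ σ a → (∀ x → x ∈var a → σ x ≡ var x) → sub σ a ≡ a
sub-fixes σ (var y) h = h y refl
sub-fixes σ (a ∧ b) h = cong₂ _∧_ (sub-fixes σ a (λ x → h x ∘ inj₁)) (sub-fixes σ b (λ x → h x ∘ inj₂))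
sub-fixes σ (a ∨ b) h = cong₂ _∨_ (sub-fixes σ a (λ x → h x ∘ inj₁)) (sub-fixes σ b (λ x → h x ∘ inj₂))
sub-fixes σ (a ⟶ b) h = cong₂ _⟶_ (sub-fixes σ a (λ x → h x ∘ inj₁)) (sub-fixes σ b (λ x → h x ∘ inj₂))
sub-fixes σ (¬ a) h = cong ¬_ (sub-fixes σ a h)
sub-fixes σ (I a) h = cong I (sub-fixes σ a h)
sub-fixes σ (C a) h = cong C (sub-fixes σ a h)
sub-fixes σ 𝟘 h = refl
sub-fixes σ 𝟙 h = refl

Axiom-sub : ∀ σ {a} → Axiom a → Axiom (sub σ a)
Axiom-sub σ (A1 a) = A1 _
Axiom-sub σ (A2 a) = A2 _
Axiom-sub σ (A3 a b) = A3 _ _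
Axiom-sub σ (A4 a b) = A4 _ _
Axiom-sub σ (A5 a b c) = A5 _ _ _
Axiom-sub σ (A6 a b c) = A6 _ _ _
Axiom-sub σ (A7 a b) = A7 _ _
Axiom-sub σ (A8 a b) = A8 _ _
Axiom-sub σ (A9 a) = A9 _
Axiom-sub σ (A10 a) = A10 _
Axiom-sub σ (A11 a) = A11 _
Axiom-sub σ (A12 a b) = A12 _ _
Axiom-sub σ (A13 a b) = A13 _ _
Axiom-sub σ (A14 a b) = A14 _ _

⊢HPRLre-sub : ∀ σ {a} → ⊢HPRLre a → ⊢HPRLre (sub σ a)
⊢HPRLre-sub σ (ax α) = ax (Axiom-sub σ α)
⊢HPRLre-sub σ (R1′ {a} {b} a⊆b d e) = R1′ (sub-⊆var σ {a} {b} a⊆b) (⊢HPRLre-sub σ d) (⊢HPRLre-sub σ e)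
⊢HPRLre-sub σ (R2′ {a} {b} {c} b⊆a∪c d e) = R2′ (sub-⊆var∪ σ {a} {b} {c} b⊆a∪c) (⊢HPRLre-sub σ d) (⊢HPRLre-sub σ e)
⊢HPRLre-sub σ (R3 b d) = R3 (sub σ b) (⊢HPRLre-sub σ d)
⊢HPRLre-sub σ (R4 d) = R4 (⊢HPRLre-sub σ d)
⊢HPRLre-sub σ (R5 d e) = R5 (⊢HPRLre-sub σ d) (⊢HPRLre-sub σ e)
⊢HPRLre-sub σ (R6 d e f g) = R6 (⊢HPRLre-sub σ d) (⊢HPRLre-sub σ e) (⊢HPRLre-sub σ f) (⊢HPRLre-sub σ g)
⊢HPRLre-sub σ (R7 d) = R7 (⊢HPRLre-sub σ d)
⊢HPRLre-sub σ (R8 d) = R8 (⊢HPRLre-sub σ d)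
⊢HPRLre-sub σ (R9 d e) = R9 (⊢HPRLre-sub σ d) (⊢HPRLre-sub σ e)

_∈var?_ : ∀ x a → Dec (x ∈var a)
x ∈var? var y = x ≟ y
x ∈var? (a ∧ b) = (x ∈var? a) ⊎-dec (x ∈var? b)
x ∈var? (a ∨ b) = (x ∈var? a) ⊎-dec (x ∈var? b)
x ∈var? (a ⟶ b) = (x ∈var? a) ⊎-dec (x ∈var? b)
x ∈var? (¬ a) = x ∈var? a
x ∈var? I a = x ∈var? a
x ∈var? C a = x ∈var? a
x ∈var? 𝟘 = no λ ()
x ∈var? 𝟙 = no λ ()

restrictTo : Fm → Subst
restrictTo b x with x ∈var? b
... | yes _ = var x
... | no _ = 𝟙

restrictTo-fixes : ∀ b x → x ∈var b → restrictTo b x ≡ var x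
restrictTo-fixes b x x∈b with x ∈var? b
... | yes _ = refl
... | no x∉b with () ← x∉b x∈b

∈var-restrictTo : ∀ b {x} y → x ∈var restrictTo b y → x ∈var b
∈var-restrictTo b y m with y ∈var? b
∈var-restrictTo b y refl | yes y∈b = y∈b

sub-restrictTo-⊆var : ∀ a b → sub (restrictTo b) a ⊆var b
sub-restrictTo-⊆var a b x m with ∈var-sub⁻ (restrictTo b) a m
... | y , _ , x∈σy = ∈var-restrictTo b y x∈σy

sub-restrictTo-fixes : ∀ {a b} → a ⊆var b → sub (restrictTo b) a ≡ a
sub-restrictTo-fixes {a} {b} a⊆b = sub-fixes (restrictTo b) a (λ x → restrictTo-fixes b x ∘ a⊆b x)

R1-admissible : ∀ {a b} → ⊢HPRLre a → ⊢HPRLre (a ⟶ b) → ⊢HPRLre b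
R1-admissible {a} {b} d e =
  R1′ (sub-restrictTo-⊆var a b) (⊢HPRLre-sub σ d)
      (subst (λ b′ → ⊢HPRLre (sub σ a ⟶ b′)) σb≡b (⊢HPRLre-sub σ e))
  where
    σ = restrictTo b
    σb≡b : sub σ b ≡ b
    σb≡b = sub-restrictTo-fixes (λ _ x∈b → x∈b)

R2-admissible : ∀ {a b c} → ⊢HPRLre (a ⟶ b) → ⊢HPRLre (b ⟶ c) → ⊢HPRLre (a ⟶ c)
R2-admissible {a} {b} {c} d e =
  subst₂ (λ a′ c′ → ⊢HPRLre (a′ ⟶ c′)) σa≡a σc≡c
    (R2′ side-condition (⊢HPRLre-sub σ d) (⊢HPRLre-sub σ e))
  where
    σ = restrictTo (a ⟶ c)
    σa≡a : sub σ a ≡ a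
    σa≡a = sub-restrictTo-fixes (λ _ → inj₁)
    σc≡c : sub σ c ≡ c
    σc≡c = sub-restrictTo-fixes (λ _ → inj₂)
    side-condition : sub σ b ⊆var sub σ a ∪ sub σ c
    side-condition rewrite σa≡a | σc≡c = sub-restrictTo-⊆var b (a ⟶ c)

HPRL⇒HPRLre : ∀ {φ} → ⊢HPRL φ → ⊢HPRLre φ
HPRL⇒HPRLre (ax α) = ax α
HPRL⇒HPRLre (R1 d e) = R1-admissible (HPRL⇒HPRLre d) (HPRL⇒HPRLre e)
HPRL⇒HPRLre (R2 d e) = R2-admissible (HPRL⇒HPRLre d) (HPRL⇒HPRLre e)
HPRL⇒HPRLre (R3 b d) = R3 b (HPRL⇒HPRLre d)
HPRL⇒HPRLre (R4 d) = R4 (HPRL⇒HPRLre d)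
HPRL⇒HPRLre (R5 d e) = R5 (HPRL⇒HPRLre d) (HPRL⇒HPRLre e)
HPRL⇒HPRLre (R6 d e f g) = R6 (HPRL⇒HPRLre d) (HPRL⇒HPRLre e) (HPRL⇒HPRLre f) (HPRL⇒HPRLre g)
HPRL⇒HPRLre (R7 d) = R7 (HPRL⇒HPRLre d)
HPRL⇒HPRLre (R8 d) = R8 (HPRL⇒HPRLre d)
HPRL⇒HPRLre (R9 d e) = R9 (HPRL⇒HPRLre d) (HPRL⇒HPRLre e)

HPRLre⇒HPRL : ∀ {φ} → ⊢HPRLre φ → ⊢HPRL φ
HPRLre⇒HPRL (ax α) = ax α
HPRLre⇒HPRL (R1′ _ d e) = R1 (HPRLre⇒HPRL d) (HPRLre⇒HPRL e)
HPRLre⇒HPRL (R2′ _ d e) = R2 (HPRLre⇒HPRL d) (HPRLre⇒HPRL e)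
HPRLre⇒HPRL (R3 b d) = R3 b (HPRLre⇒HPRL d)
HPRLre⇒HPRL (R4 d) = R4 (HPRLre⇒HPRL d)
HPRLre⇒HPRL (R5 d e) = R5 (HPRLre⇒HPRL d) (HPRLre⇒HPRL e)
HPRLre⇒HPRL (R6 d e f g) = R6 (HPRLre⇒HPRL d) (HPRLre⇒HPRL e) (HPRLre⇒HPRL f) (HPRLre⇒HPRL g)
HPRLre⇒HPRL (R7 d) = R7 (HPRLre⇒HPRL d)
HPRLre⇒HPRL (R8 d) = R8 (HPRLre⇒HPRL d)
HPRLre⇒HPRL (R9 d e) = R9 (HPRLre⇒HPRL d) (HPRLre⇒HPRL e)

theorem4p26 : ∀ (φ : Fm) → (⊢HPRLre φ → ⊢HPRL φ) × (⊢HPRL φ → ⊢HPRLre φ)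
theorem4p26 φ = HPRLre⇒HPRL , HPRL⇒HPRLre
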